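{- Let $p_1,q_1,p_2,q_2\in\mathbb{Z}$ with $p_1q_2-p_2q_1=1$, and let $F(x,y)=\min(0,p_1x+q_1y)$. Then for every $n\in\mathbb{Z}_{>0}$ the $n$-smoothing $S_n(F)$ is periodic in the direction $e=(q_1,-p_1)$, i.e. $S_n(F)(v)=S_n(F)(v+e)$ for all $v\in\mathbb{Z}^2$.
   Context: The discrete Laplacian is $\Delta F(x,y)=-4F(x,y)+F(x+1,y)+F(x-1,y)+F(x,y+1)+F(x,y-1)$. The function $F$ is superharmonic if $\Delta F\le0$. The deviation set is $D(F)=\{v:\Delta F(v)\ne0\}$. $B_C(A)$ is the set of points at distance at most $C$ from $A$. $\Theta_n(F)$ is the set of all $G:\mathbb{Z}^2\to\mathbb{Z}$ such that: - $\Delta G\le0$; - $F-n\le G\le F$; - $\{F\ne G\}\subset B_C(D(F))$ for some $C>0$. $S_n(F)(v)=\min\{G(v):G\in\Theta_n(F)\}$. -}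

module Defs where

open import Data.Nat using (ℕ)
open import Data.Integer using (ℤ; +_; _+_; _-_; _*_; -_; _≤_; _⊓_; ∣_∣; 0ℤ; 1ℤ)
open import Data.Product using (_×_; _,_; Σ; ∃; proj₁; proj₂)
open import Relation.Binary.PropositionalEquality using (_≡_; _≢_)

Point : Set
Point = ℤ × ℤ

_⊕_ : Point → Point → Point
(a , b) ⊕ (c , d) = (a + c) , (b + d)

Δ : (Point → ℤ) → Point → ℤ
Δ F (x , y) =
  (- (+ 4 * F (x , y))) + F (x + 1ℤ , y) + F (x - 1ℤ , y)
    + F (x , y + 1ℤ) + F (x , y - 1ℤ)

Superharmonic : (Point → ℤ) → Set
Superharmonic G = ∀ v → Δ G v ≤ 0ℤ

InD : (Point → ℤ) → Point → Set
InD F v = Δ F v ≢ 0ℤ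

-- ℓ¹ distance on ℤ² (any norm gives the same notion of "B_C for some C")
dist : Point → Point → ℕ
dist (a , b) (c , d) = Data.Nat._+_ ∣ a - c ∣ ∣ b - d ∣
  where import Data.Nat

InBall : ℕ → (Point → ℤ) → Point → Set
InBall C F v = ∃ λ w → InD F w × Data.Nat._≤_ (dist v w) C
  where import Data.Nat

Θ : ℕ → (Point → ℤ) → (Point → ℤ) → Set
Θ n F G =
  Superharmonic G
  × (∀ v → (F v - + n) ≤ G v × G v ≤ F v)
  × (∃ λ (C : ℕ) → ∀ v → F v ≢ G v → InBall C F v)

IsSmoothing : ℕ → (Point → ℤ) → (Point → ℤ) → Set
IsSmoothing n F S =
  ∀ v → (∃ λ G → Θ n F G × G v ≡ S v) × (∀ G → Θ n F G → S v ≤ G v)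

Fpq : ℤ → ℤ → Point → ℤ
Fpq p q (x , y) = 0ℤ ⊓ (p * x + q * y)

-- Idea: translation by a period t of F maps Θₙ(F) to itself, because the
-- Laplacian, the deviation set D(F) and the ℓ¹ distance all commute with
-- translations.  Hence if G ∈ Θₙ(F) realises Sₙ(F)(v ⊕ t), the translate
-- w ↦ G (w ⊕ t) is a competitor at v, giving Sₙ(F)(v) ≤ Sₙ(F)(v ⊕ t); the
-- reverse inequality is the same argument for the period -t.
module Submission where

open import Defs
open import Data.Nat using (ℕ; suc)
import Data.Nat as ℕ
open import Data.Integer using (ℤ; _*_; _-_; -_; 1ℤ; _+_; _≤_; _⊓_; +_; 0ℤ; ∣_∣)
open import Data.Integer.Properties using (≤-antisym)
open import Data.Integer.Tactic.RingSolver using (solve-∀)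
open import Data.Product using (_,_; _×_; proj₂)
open import Relation.Binary.PropositionalEquality

translate : {A : Set} → (Point → A) → Point → Point → A
translate f t w = f (w ⊕ t)

Periodic : {A : Set} → (Point → A) → Point → Set
Periodic f t = ∀ v → f (v ⊕ t) ≡ f v

neg : Point → Point
neg (a , b) = (- a , - b)

private
  neg-cancelˡ : ∀ (x a : ℤ) → (x + - a) + a ≡ x
  neg-cancelˡ = solve-∀
  neg-cancelʳ : ∀ (x a : ℤ) → (x + a) + - a ≡ x
  neg-cancelʳ = solve-∀
  plus-one-comm : ∀ (x a : ℤ) → (x + a) + 1ℤ ≡ (x + 1ℤ) + a
  plus-one-comm = solve-∀
  minus-one-comm : ∀ (x a : ℤ) → (x + a) - 1ℤ ≡ (x - 1ℤ) + a
  minus-one-comm = solve-∀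

⊕-neg-cancel : ∀ w t → (w ⊕ neg t) ⊕ t ≡ w
⊕-neg-cancel (x , y) (a , b) = cong₂ _,_ (neg-cancelˡ x a) (neg-cancelˡ y b)

⊕-neg-cancel′ : ∀ w t → (w ⊕ t) ⊕ neg t ≡ w
⊕-neg-cancel′ (x , y) (a , b) = cong₂ _,_ (neg-cancelʳ x a) (neg-cancelʳ y b)

dist-translate : ∀ v w t → dist (v ⊕ t) (w ⊕ t) ≡ dist v w
dist-translate (x , y) (c , d) (a , b) =
  cong₂ (λ u₁ u₂ → ∣ u₁ ∣ ℕ.+ ∣ u₂ ∣) (shift x c a) (shift y d b)
  where
  shift : ∀ (x c a : ℤ) → (x + a) - (c + a) ≡ x - c
  shift = solve-∀

Δ-translate : ∀ G t v → Δ (translate G t) v ≡ Δ G (v ⊕ t)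
Δ-translate G (a , b) (x , y)
  rewrite plus-one-comm x a | minus-one-comm x a
        | plus-one-comm y b | minus-one-comm y b = refl

Δ-ext : ∀ F G → (∀ w → F w ≡ G w) → ∀ v → Δ F v ≡ Δ G v
Δ-ext F G F≡G (x , y)
  rewrite F≡G (x , y) | F≡G (x + 1ℤ , y) | F≡G (x - 1ℤ , y)
        | F≡G (x , y + 1ℤ) | F≡G (x , y - 1ℤ) = refl

periodic-neg : ∀ {A : Set} (f : Point → A) t → Periodic f t → Periodic f (neg t)
periodic-neg f t per v = trans (sym (per (v ⊕ neg t))) (cong f (⊕-neg-cancel v t))

Δ-periodic : ∀ F t → Periodic F t → Periodic (Δ F) t
Δ-periodic F t per v = trans (sym (Δ-translate F t v)) (Δ-ext (translate F t) F per v)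

inBall-periodic : ∀ C F t → Periodic F t →
  ∀ v → InBall C F (v ⊕ t) → InBall C F v
inBall-periodic C F t per v (w , w∈D , dist≤C) =
  w ⊕ neg t , w-t∈D , subst (ℕ._≤ C) (sym dist-v) dist≤C
  where
  w-t∈D : InD F (w ⊕ neg t)
  w-t∈D ΔF≡0 = w∈D (trans (sym (periodic-neg (Δ F) t (Δ-periodic F t per) w)) ΔF≡0)
  dist-v : dist v (w ⊕ neg t) ≡ dist (v ⊕ t) w
  dist-v = trans (sym (dist-translate v (w ⊕ neg t) t)) (cong (dist (v ⊕ t)) (⊕-neg-cancel w t))

Θ-translate : ∀ n F G t → Periodic F t → Θ n F G → Θ n F (translate G t)
Θ-translate n F G t per (superharmonic , bounds , C , deviation) =
  superharmonic′ , bounds′ , C , deviation′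
  where
  superharmonic′ : Superharmonic (translate G t)
  superharmonic′ v = subst (_≤ 0ℤ) (sym (Δ-translate G t v)) (superharmonic (v ⊕ t))
  bounds′ : ∀ v → (F v - + n) ≤ G (v ⊕ t) × G (v ⊕ t) ≤ F v
  bounds′ v = subst (λ z → (z - + n) ≤ G (v ⊕ t) × G (v ⊕ t) ≤ z) (per v) (bounds (v ⊕ t))
  deviation′ : ∀ v → F v ≢ G (v ⊕ t) → InBall C F v
  deviation′ v F≢G = inBall-periodic C F t per v
    (deviation (v ⊕ t) (λ F≡G → F≢G (trans (sym (per v)) F≡G)))

smoothing-≤-translate : ∀ n F S t → Periodic F t → IsSmoothing n F S →
  ∀ v → S v ≤ S (v ⊕ t)
smoothing-≤-translate n F S t per smoothing v
  with smoothing (v ⊕ t)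
... | (G , G∈Θ , G≡S) , _ =
  subst (S v ≤_) G≡S (minimal (translate G t) (Θ-translate n F G t per G∈Θ))
  where
  minimal : ∀ G → Θ n F G → S v ≤ G v
  minimal = proj₂ (smoothing v)

smoothing-periodic : ∀ n F S t → Periodic F t → IsSmoothing n F S →
  ∀ v → S v ≡ S (v ⊕ t)
smoothing-periodic n F S t per smoothing v = ≤-antisym
  (smoothing-≤-translate n F S t per smoothing v)
  (subst (S (v ⊕ t) ≤_) (cong S (⊕-neg-cancel′ v t))
    (smoothing-≤-translate n F S (neg t) (periodic-neg F t per) smoothing (v ⊕ t)))

Fpq-periodic : ∀ p q → Periodic (Fpq p q) (q , - p)
Fpq-periodic p q (x , y) = cong (0ℤ ⊓_) (level p q x y)
  where
  level : ∀ (p q x y : ℤ) → p * (x + q) + q * (y + - p) ≡ p * x + q * y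
  level = solve-∀

-- Lemma 7.3: the smoothing of min(0, p₁x + q₁y) is periodic in direction (q₁, -p₁).
-- Only the invariance of F along (q₁, -p₁) is needed, not the unimodularity.
lemma7p3 : (p₁ q₁ p₂ q₂ : ℤ) → p₁ * q₂ - p₂ * q₁ ≡ 1ℤ →
    (n : ℕ) → (S : Point → ℤ) → IsSmoothing (suc n) (Fpq p₁ q₁) S →
    ∀ v → S v ≡ S (v ⊕ (q₁ , - p₁))
lemma7p3 p₁ q₁ _ _ _ n S smoothing =
  smoothing-periodic (suc n) (Fpq p₁ q₁) S (q₁ , - p₁) (Fpq-periodic p₁ q₁) smoothing
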